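{- Let $n,m\ge 3$ be integers. Then (i) $\mu_{\rm d}(K_n \,\square\, K_m) = n+m-1$, and (ii) $\mu_{\rm o}(K_n \,\square\, K_m) = n+m-2$.
   Context: $K_n\,\square\,K_m$ is the Cartesian product of complete graphs: vertex set $[n]\times[m]$, with $(i,j)$ adjacent to $(i',j')$ iff either $i=i'$ and $j\ne j'$, or $j=j'$ and $i\neq i'$. For a connected graph $G$ and $X\subseteq V(G)$, two vertices $x,y$ are $X$-visible if there is a shortest $x,y$-path whose internal vertices are not in $X$. $X$ is a dual mutual-visibility set if every two vertices of $X$ are $X$-visible and every two vertices of $V(G)\setminus X$ are $X$-visible; $X$ is an outer mutual-visibility set if every two vertices of $X$ are $X$-visible and every $x\in X$, $y\in V(G)\setminus X$ are $X$-visible. $\mu_{\rm d}(G)$ and $\mu_{\rm o}(G)$ denote the maximum cardinality of a dual, respectively outer, mutual-visibility set of $G$. -}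

module Defs where

open import Data.Nat using (ℕ; zero; suc; _+_; _≤_)
open import Data.Bool using (Bool; true; false; if_then_else_)
open import Data.Fin using (Fin)
open import Data.List using (List; []; _∷_; map; cartesianProduct; allFin)
open import Data.Nat.ListAction using (sum)
open import Data.List.Relation.Unary.All using (All)
open import Data.Product using (_×_; _,_; Σ; ∃; ∃-syntax)
open import Data.Sum using (_⊎_)
open import Relation.Binary.PropositionalEquality using (_≡_; _≢_)

record Graph : Set₁ where
  field
    V   : Set
    Adj : V → V → Set
open Graph public

data Walk (G : Graph) : V G → V G → Set where
  []  : ∀ {x} → Walk G x x
  _∷_ : ∀ {x y z} → Adj G x y → Walk G y z → Walk G x z

walkLength : ∀ {G x y} → Walk G x y → ℕ
walkLength [] = 0
walkLength (_ ∷ w) = suc (walkLength w)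

internal : ∀ {G x y} → Walk G x y → List (V G)
internal [] = []
internal (_ ∷ []) = []
internal (_∷_ {y = y} _ (e ∷ w)) = y ∷ internal (e ∷ w)

-- A shortest x,y-path: a walk from x to y no longer than any other x,y-walk
-- (such a walk is necessarily a path).
IsShortest : ∀ {G x y} → Walk G x y → Set
IsShortest {G} {x} {y} w = ∀ (w' : Walk G x y) → walkLength w ≤ walkLength w'

VSet : Graph → Set
VSet G = V G → Bool

Visible : (G : Graph) → VSet G → V G → V G → Set
Visible G X x y =
  Σ (Walk G x y) λ w → IsShortest w × All (λ v → X v ≡ false) (internal w)

IsDualMV : (G : Graph) → VSet G → Set
IsDualMV G X =
  (∀ x y → X x ≡ true → X y ≡ true → Visible G X x y) ×
  (∀ x y → X x ≡ false → X y ≡ false → Visible G X x y)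

IsOuterMV : (G : Graph) → VSet G → Set
IsOuterMV G X =
  (∀ x y → X x ≡ true → X y ≡ true → Visible G X x y) ×
  (∀ x y → X x ≡ true → X y ≡ false → Visible G X x y)

KK : ℕ → ℕ → Graph
KK n m = record
  { V   = Fin n × Fin m
  ; Adj = λ { (i , j) (i' , j') → (i ≡ i' × j ≢ j') ⊎ (j ≡ j' × i ≢ i') } }

vertsKK : ∀ n m → List (Fin n × Fin m)
vertsKK n m = cartesianProduct (allFin n) (allFin m)

cardKK : ∀ n m → VSet (KK n m) → ℕ
cardKK n m X = sum (map (λ v → if X v then 1 else 0) (vertsKK n m))

IsMaxCardKK : ∀ n m → (VSet (KK n m) → Set) → ℕ → Set
IsMaxCardKK n m P k =
  (∃[ X ] (P X × cardKK n m X ≡ k)) × (∀ X → P X → cardKK n m X ≤ k)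

-- Two vertices of K_n □ K_m in different rows and columns are at distance 2, and their shortest paths
-- run exactly through the two other corners of the rectangle they span. Hence a dual mutual-visibility
-- set contains no full rectangle and no rectangle with one diagonal inside and the other outside, and
-- an outer one contains no three corners of a rectangle. In either case X splits into a part with at
-- most one element per row and a part with at most one element per column, leaving a column free (for
-- outer sets also a row, unless one part is empty), which gives n + m - 1 and n + m - 2. The first row
-- together with the first column attains the first bound, and without their common vertex the second.

module Submission where

open import Defs
open import Level using (Level)
open import Data.Nat using (ℕ; zero; suc; _+_; _∸_; _≤_; _<_; z≤n; s≤s)
open import Data.Nat.Properties
  using ( ≤-reflexive; ≤-trans; m≤n⇒m≤1+n; +-mono-≤; +-assoc; +-comm; +-suc; +-identityʳ
        ; m+n≤o⇒m≤o∸n; +-0-commutativeMonoid; module ≤-Reasoning)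
open import Data.Nat.ListAction using (sum)
open import Data.Nat.ListAction.Properties using (sum-++)
open import Algebra.Properties.CommutativeMonoid.Sum +-0-commutativeMonoid
  using (sum-syntax; ∑-distrib-+; ∑-comm; sum-cong-≗; sum-replicate-zero)
open import Data.Bool using (Bool; true; false; if_then_else_)
open import Data.Bool.Properties using (not-¬; ¬-not) renaming (_≟_ to _≟ᵇ_)
open import Data.Fin using (Fin; zero; suc)
open import Data.Fin.Properties using (any?; suc-injective; 0≢1+n) renaming (_≟_ to _≟ᶠ_)
open import Data.List as List using (List; []; _∷_; map; tabulate; cartesianProduct; allFin)
open import Data.List.Properties using (map-++; map-∘; map-tabulate)
open import Data.List.Relation.Unary.All using (All; []; _∷_)
open import Data.Product using (_×_; _,_; ∃; proj₁; proj₂)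
open import Data.Sum using (_⊎_; inj₁; inj₂; [_,_]′)
open import Data.Empty using (⊥; ⊥-elim)
open import Function using (_∘_; id)
open import Relation.Nullary using (Dec; yes; no; does; ¬_)
open import Relation.Nullary.Decidable using (_×-dec_; _⊎-dec_; ¬?)
open import Relation.Binary.PropositionalEquality
  using (_≡_; _≢_; refl; sym; trans; cong; cong₂; module ≡-Reasoning)

private
  variable
    p q r : Level
    A B : Set
    n m : ℕ

∑-mono-≤ : {f g : Fin n → ℕ} → (∀ i → f i ≤ g i) → ∑[ i < n ] f i ≤ ∑[ i < n ] g i
∑-mono-≤ {zero}  _   = z≤n
∑-mono-≤ {suc n} f≤g = +-mono-≤ (f≤g zero) (∑-mono-≤ (f≤g ∘ suc))

∑≡0 : {f : Fin n → ℕ} → (∀ i → f i ≡ 0) → ∑[ i < n ] f i ≡ 0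
∑≡0 {n} f≡0 = trans (sum-cong-≗ f≡0) (sum-replicate-zero n)

∑≡n : {f : Fin n → ℕ} → (∀ i → f i ≡ 1) → ∑[ i < n ] f i ≡ n
∑≡n {zero}  _   = refl
∑≡n {suc n} f≡1 = cong₂ _+_ (f≡1 zero) (∑≡n (f≡1 ∘ suc))

∑≤n : {f : Fin n → ℕ} → (∀ i → f i ≤ 1) → ∑[ i < n ] f i ≤ n
∑≤n {zero}  _   = z≤n
∑≤n {suc n} f≤1 = +-mono-≤ (f≤1 zero) (∑≤n (f≤1 ∘ suc))

∑<n : {f : Fin n → ℕ} (i : Fin n) → (∀ i → f i ≤ 1) → f i ≡ 0 → ∑[ i < n ] f i < n
∑<n {suc n} zero    f≤1 f0≡0 rewrite f0≡0 = s≤s (∑≤n (f≤1 ∘ suc))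
∑<n {suc n} {f} (suc i) f≤1 fi≡0 = begin
  suc (f zero + ∑[ k < n ] f (suc k)) ≡⟨ +-suc (f zero) _ ⟨
  f zero + suc (∑[ k < n ] f (suc k)) ≤⟨ +-mono-≤ (f≤1 zero) (∑<n i (f≤1 ∘ suc) fi≡0) ⟩
  1 + n                               ∎
  where open ≤-Reasoning

sum-tabulate : (f : Fin n → ℕ) → sum (tabulate f) ≡ ∑[ i < n ] f i
sum-tabulate {zero}  f = refl
sum-tabulate {suc n} f = cong (f zero +_) (sum-tabulate (f ∘ suc))

sum-map-allFin : (f : Fin n → ℕ) → sum (map f (allFin n)) ≡ ∑[ i < n ] f i
sum-map-allFin f = trans (cong sum (map-tabulate id f)) (sum-tabulate f)

sum-map-cartesianProduct : (f : A × B → ℕ) (xs : List A) (ys : List B) →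
  sum (map f (cartesianProduct xs ys)) ≡ sum (map (λ x → sum (map (λ y → f (x , y)) ys)) xs)
sum-map-cartesianProduct f []       ys = refl
sum-map-cartesianProduct f (x ∷ xs) ys = begin
  sum (map f (map (x ,_) ys List.++ cartesianProduct xs ys))
    ≡⟨ cong sum (map-++ f (map (x ,_) ys) _) ⟩
  sum (map f (map (x ,_) ys) List.++ map f (cartesianProduct xs ys))
    ≡⟨ sum-++ (map f (map (x ,_) ys)) _ ⟩
  sum (map f (map (x ,_) ys)) + sum (map f (cartesianProduct xs ys))
    ≡⟨ cong₂ _+_ (cong sum (sym (map-∘ ys))) (sum-map-cartesianProduct f xs ys) ⟩
  sum (map (λ y → f (x , y)) ys) + sum (map (λ x → sum (map (λ y → f (x , y)) ys)) xs)
    ∎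
  where open ≡-Reasoning

bit : Bool → ℕ
bit b = if b then 1 else 0

count : {P : Fin n → Set p} → (∀ i → Dec (P i)) → ℕ
count {n} P? = ∑[ i < n ] bit (does (P? i))

bit-does-yes : {P : Set p} → P → (d : Dec P) → bit (does d) ≡ 1
bit-does-yes _ (yes _) = refl
bit-does-yes P (no ¬P) = ⊥-elim (¬P P)

bit-does-no : {P : Set p} → ¬ P → (d : Dec P) → bit (does d) ≡ 0
bit-does-no ¬P (yes P) = ⊥-elim (¬P P)
bit-does-no _  (no _)  = refl

module _ {P : Fin n → Set p} (P? : ∀ i → Dec (P i)) where

  count≡0 : (∀ i → ¬ P i) → count P? ≡ 0
  count≡0 ¬P = ∑≡0 (λ i → bit-does-no (¬P i) (P? i))

  count≡n : (∀ i → P i) → count P? ≡ n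
  count≡n allP = ∑≡n (λ i → bit-does-yes (allP i) (P? i))

count≤1 : {P : Fin n → Set p} (P? : ∀ i → Dec (P i)) →
  (∀ i i' → P i → P i' → i ≡ i') → count P? ≤ 1
count≤1 {zero}  P? unique = z≤n
count≤1 {suc n} P? unique with P? zero
... | yes P0 = s≤s (≤-reflexive (count≡0 (P? ∘ suc) (λ i Pi → 0≢1+n (unique zero (suc i) P0 Pi))))
... | no _   = count≤1 (P? ∘ suc) (λ i i' Pi Pi' → suc-injective (unique (suc i) (suc i') Pi Pi'))

bit-cover : {P : Set p} {Q : Set q} {R : Set r} → (P → Q ⊎ R) →
  (P? : Dec P) (Q? : Dec Q) (R? : Dec R) → bit (does P?) ≤ bit (does Q?) + bit (does R?)
bit-cover cover (no _)  _        _        = z≤n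
bit-cover cover (yes _) (yes _)  _        = s≤s z≤n
bit-cover cover (yes _) (no _)   (yes _)  = s≤s z≤n
bit-cover cover (yes P) (no ¬Q)  (no ¬R)  = ⊥-elim ([ ¬Q , ¬R ]′ (cover P))

∑count-cover : {X : Fin n → Fin m → Set p} {R : Fin n → Fin m → Set q} {C : Fin n → Fin m → Set r} →
  (∀ i j → X i j → R i j ⊎ C i j) →
  (X? : ∀ i j → Dec (X i j)) (R? : ∀ i j → Dec (R i j)) (C? : ∀ i j → Dec (C i j)) →
  ∑[ i < n ] count (X? i) ≤ ∑[ i < n ] count (R? i) + ∑[ j < m ] count (λ i → C? i j)
∑count-cover {n} {m} cover X? R? C? = begin
  ∑[ i < n ] ∑[ j < m ] bit (does (X? i j))
    ≤⟨ ∑-mono-≤ (λ i → ∑-mono-≤ (λ j → bit-cover (cover i j) (X? i j) (R? i j) (C? i j))) ⟩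
  ∑[ i < n ] ∑[ j < m ] (bit (does (R? i j)) + bit (does (C? i j)))
    ≡⟨ sum-cong-≗ (λ i → ∑-distrib-+ (λ j → bit (does (R? i j))) (λ j → bit (does (C? i j)))) ⟩
  ∑[ i < n ] (count (R? i) + ∑[ j < m ] bit (does (C? i j)))
    ≡⟨ ∑-distrib-+ (λ i → count (R? i)) (λ i → ∑[ j < m ] bit (does (C? i j))) ⟩
  ∑[ i < n ] count (R? i) + ∑[ i < n ] ∑[ j < m ] bit (does (C? i j))
    ≡⟨ cong (∑[ i < n ] count (R? i) +_) (∑-comm (λ i j → bit (does (C? i j)))) ⟩
  ∑[ i < n ] count (R? i) + ∑[ j < m ] count (λ i → C? i j)
    ∎
  where open ≤-Reasoning

does-≟-true : ∀ b → does (b ≟ᵇ true) ≡ b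
does-≟-true true  = refl
does-≟-true false = refl

cardKK≡∑count : ∀ (X : VSet (KK n m)) → cardKK n m X ≡ ∑[ i < n ] count (λ j → X (i , j) ≟ᵇ true)
cardKK≡∑count {n} {m} X = begin
  cardKK n m X
    ≡⟨ sum-map-cartesianProduct (bit ∘ X) (allFin n) (allFin m) ⟩
  sum (map (λ i → sum (map (λ j → bit (X (i , j))) (allFin m))) (allFin n))
    ≡⟨ sum-map-allFin {n} _ ⟩
  ∑[ i < n ] sum (map (λ j → bit (X (i , j))) (allFin m))
    ≡⟨ sum-cong-≗ {n} (λ i → sum-map-allFin {m} _) ⟩
  ∑[ i < n ] ∑[ j < m ] bit (X (i , j))
    ≡⟨ sum-cong-≗ {n} (λ i → sum-cong-≗ (λ j → cong bit (sym (does-≟-true (X (i , j)))))) ⟩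
  ∑[ i < n ] count (λ j → X (i , j) ≟ᵇ true)
    ∎
  where open ≡-Reasoning

walkLength≥1 : {G : Graph} {x y : V G} → x ≢ y → (w : Walk G x y) → 1 ≤ walkLength w
walkLength≥1 x≢y []      = ⊥-elim (x≢y refl)
walkLength≥1 _   (_ ∷ _) = s≤s z≤n

CornerOutside : VSet (KK n m) → Fin n × Fin m → Fin n × Fin m → Set
CornerOutside X (i , j) (i' , j') = X (i , j') ≡ false ⊎ X (i' , j) ≡ false

module _ {i i' : Fin n} {j j' : Fin m} (i≢i' : i ≢ i') (j≢j' : j ≢ j') where

  walkLength≥2 : (w : Walk (KK n m) (i , j) (i' , j')) → 2 ≤ walkLength w
  walkLength≥2 []                         = ⊥-elim (i≢i' refl)
  walkLength≥2 (inj₁ (refl , _) ∷ [])     = ⊥-elim (i≢i' refl)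
  walkLength≥2 (inj₂ (refl , _) ∷ [])     = ⊥-elim (j≢j' refl)
  walkLength≥2 (_ ∷ _ ∷ _)                = s≤s (s≤s z≤n)

  visible⇒cornerOutside : (X : VSet (KK n m)) → Visible (KK n m) X (i , j) (i' , j') →
    CornerOutside X (i , j) (i' , j')
  visible⇒cornerOutside X (w , shortest , outside) =
    throughCorner w (shortest (inj₁ (refl , j≢j') ∷ inj₂ (refl , i≢i') ∷ [])) outside
    where
    throughCorner : (w : Walk (KK n m) (i , j) (i' , j')) → walkLength w ≤ 2 →
      All (λ v → X v ≡ false) (internal w) → CornerOutside X (i , j) (i' , j')
    throughCorner []                                         _ _ = ⊥-elim (i≢i' refl)
    throughCorner (inj₁ (refl , _) ∷ [])                     _ _ = ⊥-elim (i≢i' refl)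
    throughCorner (inj₂ (refl , _) ∷ [])                     _ _ = ⊥-elim (j≢j' refl)
    throughCorner (inj₁ (refl , _) ∷ inj₁ (refl , _) ∷ [])   _ _ = ⊥-elim (i≢i' refl)
    throughCorner (inj₁ (refl , _) ∷ inj₂ (refl , _) ∷ [])   _ (out ∷ []) = inj₁ out
    throughCorner (inj₂ (refl , _) ∷ inj₁ (refl , _) ∷ [])   _ (out ∷ []) = inj₂ out
    throughCorner (inj₂ (refl , _) ∷ inj₂ (refl , _) ∷ [])   _ _ = ⊥-elim (j≢j' refl)
    throughCorner (_ ∷ _ ∷ _ ∷ _) (s≤s (s≤s ())) _

cornerOutside⇒visible : (X : VSet (KK n m)) {i i' : Fin n} {j j' : Fin m} →
  (i ≢ i' → j ≢ j' → CornerOutside X (i , j) (i' , j')) → Visible (KK n m) X (i , j) (i' , j')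
cornerOutside⇒visible X {i} {i'} {j} {j'} corner with i ≟ᶠ i' | j ≟ᶠ j'
... | yes refl | yes refl = [] , (λ _ → z≤n) , []
... | yes refl | no j≢j'  = inj₁ (refl , j≢j') ∷ [] , walkLength≥1 (j≢j' ∘ cong proj₂) , []
... | no i≢i'  | yes refl = inj₂ (refl , i≢i') ∷ [] , walkLength≥1 (i≢i' ∘ cong proj₁) , []
... | no i≢i'  | no j≢j' with corner i≢i' j≢j'
...   | inj₁ out = inj₁ (refl , j≢j') ∷ inj₂ (refl , i≢i') ∷ [] , walkLength≥2 i≢i' j≢j' , out ∷ []
...   | inj₂ out = inj₂ (refl , i≢i') ∷ inj₁ (refl , j≢j') ∷ [] , walkLength≥2 i≢i' j≢j' , out ∷ []

module _ {X : VSet (KK n m)} {i i' : Fin n} {j j' : Fin m} (i≢i' : i ≢ i') (j≢j' : j ≢ j') where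

  dual⇒noFullRectangle : IsDualMV (KK n m) X →
    X (i , j) ≡ true → X (i , j') ≡ true → X (i' , j) ≡ true → X (i' , j') ≡ true → ⊥
  dual⇒noFullRectangle (inX , _) x₁ x₂ x₃ x₄ =
    [ not-¬ x₂ , not-¬ x₃ ]′ (visible⇒cornerOutside i≢i' j≢j' X (inX _ _ x₁ x₄))

  dual⇒noCheckerboard : IsDualMV (KK n m) X →
    X (i , j) ≡ true → X (i' , j') ≡ true → X (i , j') ≡ false → X (i' , j) ≡ false → ⊥
  dual⇒noCheckerboard (_ , outX) x₁ x₄ y₂ y₃ =
    [ not-¬ x₁ , not-¬ x₄ ]′ (visible⇒cornerOutside i≢i' (j≢j' ∘ sym) X (outX _ _ y₂ y₃))

  outer⇒noThreeCorners : IsOuterMV (KK n m) X →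
    X (i , j) ≡ true → X (i , j') ≡ true → X (i' , j) ≡ true → ⊥
  outer⇒noThreeCorners (inX , outX) x₁ x₂ x₃ with X (i' , j') ≟ᵇ true
  ... | yes x₄ = [ not-¬ x₂ , not-¬ x₃ ]′ (visible⇒cornerOutside i≢i' j≢j' X (inX _ _ x₁ x₄))
  ... | no ¬x₄ = [ not-¬ x₂ , not-¬ x₃ ]′ (visible⇒cornerOutside i≢i' j≢j' X (outX _ _ x₁ (¬-not ¬x₄)))

+≤+∸1 : ∀ {a b c d} → a ≤ c → b < d → a + b ≤ c + d ∸ 1
+≤+∸1 {a} {b} a≤c b<d = m+n≤o⇒m≤o∸n (a + b) (begin
  a + b + 1   ≡⟨ +-assoc a b 1 ⟩
  a + (b + 1) ≡⟨ cong (a +_) (+-comm b 1) ⟩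
  a + suc b   ≤⟨ +-mono-≤ a≤c b<d ⟩
  _           ∎)
  where open ≤-Reasoning

+≤+∸2 : ∀ {a b c d} → 2 ≤ c → 2 ≤ d → a ≤ c → b ≤ d → a ≡ 0 ⊎ b < d → b ≡ 0 ⊎ a < c → a + b ≤ c + d ∸ 2
+≤+∸2 {b = b} {c} {d} 2≤c _ _ b≤d (inj₁ refl) _ = m+n≤o⇒m≤o∸n b (begin
  b + 2 ≡⟨ +-comm b 2 ⟩
  2 + b ≤⟨ +-mono-≤ 2≤c b≤d ⟩
  c + d ∎)
  where open ≤-Reasoning
+≤+∸2 {a} {c = c} {d} _ 2≤d a≤c _ _ (inj₁ refl) = m+n≤o⇒m≤o∸n (a + 0) (begin
  a + 0 + 2 ≡⟨ cong (_+ 2) (+-identityʳ a) ⟩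
  a + 2     ≤⟨ +-mono-≤ a≤c 2≤d ⟩
  c + d     ∎)
  where open ≤-Reasoning
+≤+∸2 {a} {b} {c} {d} _ _ _ _ (inj₂ b<d) (inj₂ a<c) = m+n≤o⇒m≤o∸n (a + b) (begin
  a + b + 2     ≡⟨ +-comm (a + b) 2 ⟩
  2 + (a + b)   ≡⟨ cong suc (+-suc a b) ⟨
  suc a + suc b ≤⟨ +-mono-≤ a<c b<d ⟩
  c + d         ∎)
  where open ≤-Reasoning

card≡0 : (X : VSet (KK n m)) → (∀ i j → X (i , j) ≢ true) → cardKK n m X ≡ 0
card≡0 X ∅ = trans (cardKK≡∑count X) (∑≡0 (λ i → count≡0 (λ j → X (i , j) ≟ᵇ true) (∅ i)))

-- An element outside column b whose row meets column b in X goes to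
-- Col; every other element goes to Row, and then its column meets row a in X (no checkerboard).
-- Full rectangles are excluded, so Row has at most one element per row and Col at most one per column.
module DualPivot {X : VSet (KK n m)} (dual : IsDualMV (KK n m) X) {a : Fin n} {b : Fin m}
                 (ab : X (a , b) ≡ true) where

  Row Col : Fin n → Fin m → Set
  Row i j = X (i , j) ≡ true × (X (i , b) ≡ false ⊎ j ≡ b)
  Col i j = X (i , j) ≡ true × X (i , b) ≡ true × j ≢ b

  Row? : ∀ i j → Dec (Row i j)
  Row? i j = (X (i , j) ≟ᵇ true) ×-dec ((X (i , b) ≟ᵇ false) ⊎-dec (j ≟ᶠ b))

  Col? : ∀ i j → Dec (Col i j)
  Col? i j = (X (i , j) ≟ᵇ true) ×-dec ((X (i , b) ≟ᵇ true) ×-dec ¬? (j ≟ᶠ b))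

  cover : ∀ i j → X (i , j) ≡ true → Row i j ⊎ Col i j
  cover i j x with X (i , b) ≟ᵇ true | j ≟ᶠ b
  ... | no ¬y | _       = inj₁ (x , inj₁ (¬-not ¬y))
  ... | yes y | yes j≡b = inj₁ (x , inj₂ j≡b)
  ... | yes y | no j≢b  = inj₂ (x , y , j≢b)

  aboveInX : ∀ {i j} → X (i , j) ≡ true → X (i , b) ≡ false → X (a , j) ≡ true
  aboveInX x y with X (a , _) ≟ᵇ true
  ... | yes above = above
  ... | no ¬above = ⊥-elim (dual⇒noCheckerboard (λ { refl → not-¬ ab y }) (λ { refl → not-¬ x y })
                                                dual ab x (¬-not ¬above) y)

  rows≤1 : ∀ i → count (Row? i) ≤ 1
  rows≤1 i = count≤1 (Row? i) unique
    where
    unique : ∀ j j' → Row i j → Row i j' → j ≡ j'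
    unique j j' (x , inj₂ refl) (x' , inj₂ refl) = refl
    unique j j' (x , inj₁ y)    (x' , inj₂ refl) = ⊥-elim (not-¬ x' y)
    unique j j' (x , inj₂ refl) (x' , inj₁ y)    = ⊥-elim (not-¬ x y)
    unique j j' (x , inj₁ y)    (x' , inj₁ _) with j ≟ᶠ j'
    ... | yes j≡j' = j≡j'
    ... | no j≢j'  = ⊥-elim (dual⇒noFullRectangle (λ { refl → not-¬ ab y }) j≢j' dual
                                                 x x' (aboveInX x y) (aboveInX x' y))

  cols≤1 : ∀ j → count (λ i → Col? i j) ≤ 1
  cols≤1 j = count≤1 (λ i → Col? i j) unique
    where
    unique : ∀ i i' → Col i j → Col i' j → i ≡ i'
    unique i i' (x , y , j≢b) (x' , y' , _) with i ≟ᶠ i'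
    ... | yes i≡i' = i≡i'
    ... | no i≢i'  = ⊥-elim (dual⇒noFullRectangle i≢i' j≢b dual x y x' y')

  card≤ : cardKK n m X ≤ n + m ∸ 1
  card≤ = begin
    cardKK n m X
      ≡⟨ cardKK≡∑count X ⟩
    ∑[ i < n ] count (λ j → X (i , j) ≟ᵇ true)
      ≤⟨ ∑count-cover cover (λ i j → X (i , j) ≟ᵇ true) Row? Col? ⟩
    ∑[ i < n ] count (Row? i) + ∑[ j < m ] count (λ i → Col? i j)
      ≤⟨ +≤+∸1 (∑≤n rows≤1) (∑<n b cols≤1 (count≡0 (λ i → Col? i b) (λ i c → proj₂ (proj₂ c) refl))) ⟩
    n + m ∸ 1
      ∎
    where open ≤-Reasoning

dual-card≤ : {X : VSet (KK n m)} → IsDualMV (KK n m) X → cardKK n m X ≤ n + m ∸ 1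
dual-card≤ {X = X} dual with any? (λ i → any? (λ j → X (i , j) ≟ᵇ true))
... | yes (_ , _ , ab) = DualPivot.card≤ dual ab
... | no ∅             = ≤-trans (≤-reflexive (card≡0 X (λ i j x → ∅ (i , j , x)))) z≤n

-- No three corners
-- of a rectangle lie in X, so Row has at most one element per row; moreover a column meeting Row misses
-- Col, and a row meeting Col misses Row.
module OuterSplit {X : VSet (KK n m)} (outer : IsOuterMV (KK n m) X) where

  Shared : Fin n → Fin m → Set
  Shared i j = ∃ λ i' → i' ≢ i × X (i' , j) ≡ true

  Shared? : ∀ i j → Dec (Shared i j)
  Shared? i j = any? (λ i' → ¬? (i' ≟ᶠ i) ×-dec (X (i' , j) ≟ᵇ true))

  Row Col : Fin n → Fin m → Set
  Row i j = X (i , j) ≡ true × Shared i j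
  Col i j = X (i , j) ≡ true × ¬ Shared i j

  Row? : ∀ i j → Dec (Row i j)
  Row? i j = (X (i , j) ≟ᵇ true) ×-dec Shared? i j

  Col? : ∀ i j → Dec (Col i j)
  Col? i j = (X (i , j) ≟ᵇ true) ×-dec ¬? (Shared? i j)

  cover : ∀ i j → X (i , j) ≡ true → Row i j ⊎ Col i j
  cover i j x with Shared? i j
  ... | yes shared = inj₁ (x , shared)
  ... | no alone   = inj₂ (x , alone)

  rows≤1 : ∀ i → count (Row? i) ≤ 1
  rows≤1 i = count≤1 (Row? i) unique
    where
    unique : ∀ j j' → Row i j → Row i j' → j ≡ j'
    unique j j' (x , i' , i'≢i , x₃) (x₂ , _) with j ≟ᶠ j'
    ... | yes j≡j' = j≡j'
    ... | no j≢j'  = ⊥-elim (outer⇒noThreeCorners (i'≢i ∘ sym) j≢j' outer x x₂ x₃)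

  cols≤1 : ∀ j → count (λ i → Col? i j) ≤ 1
  cols≤1 j = count≤1 (λ i → Col? i j) unique
    where
    unique : ∀ i i' → Col i j → Col i' j → i ≡ i'
    unique i i' (x , alone) (x' , _) with i ≟ᶠ i'
    ... | yes i≡i' = i≡i'
    ... | no i≢i'  = ⊥-elim (alone (i' , i≢i' ∘ sym , x'))

  Row⇒columnMissesCol : ∀ {i j} → Row i j → ∀ i'' → ¬ Col i'' j
  Row⇒columnMissesCol {i} (x , i' , i'≢i , x') i'' (_ , alone) with i ≟ᶠ i''
  ... | yes refl = alone (i' , i'≢i , x')
  ... | no i≢i'' = alone (i , i≢i'' , x)

  Col⇒rowMissesRow : ∀ {i j} → Col i j → ∀ j' → ¬ Row i j'
  Col⇒rowMissesRow {j = j} (x , alone) j' (x' , i' , i'≢i , x'') with j ≟ᶠ j'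
  ... | yes refl = alone (i' , i'≢i , x'')
  ... | no j≢j'  = outer⇒noThreeCorners (i'≢i ∘ sym) (j≢j' ∘ sym) outer x' x x''

  noRowOrFreeColumn : ∑[ i < n ] count (Row? i) ≡ 0 ⊎ ∑[ j < m ] count (λ i → Col? i j) < m
  noRowOrFreeColumn with any? (λ i → any? (λ j → Row? i j))
  ... | yes (_ , j , r) = inj₂ (∑<n j cols≤1 (count≡0 (λ i → Col? i j) (Row⇒columnMissesCol r)))
  ... | no ∄row         = inj₁ (∑≡0 (λ i → count≡0 (Row? i) (λ j r → ∄row (i , j , r))))

  noColOrFreeRow : ∑[ j < m ] count (λ i → Col? i j) ≡ 0 ⊎ ∑[ i < n ] count (Row? i) < n
  noColOrFreeRow with any? (λ i → any? (λ j → Col? i j))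
  ... | yes (i , _ , c) = inj₂ (∑<n i rows≤1 (count≡0 (Row? i) (Col⇒rowMissesRow c)))
  ... | no ∄col         = inj₁ (∑≡0 (λ j → count≡0 (λ i → Col? i j) (λ i c → ∄col (i , j , c))))

  card≤ : 2 ≤ n → 2 ≤ m → cardKK n m X ≤ n + m ∸ 2
  card≤ 2≤n 2≤m = begin
    cardKK n m X
      ≡⟨ cardKK≡∑count X ⟩
    ∑[ i < n ] count (λ j → X (i , j) ≟ᵇ true)
      ≤⟨ ∑count-cover cover (λ i j → X (i , j) ≟ᵇ true) Row? Col? ⟩
    ∑[ i < n ] count (Row? i) + ∑[ j < m ] count (λ i → Col? i j)
      ≤⟨ +≤+∸2 2≤n 2≤m (∑≤n rows≤1) (∑≤n cols≤1) noRowOrFreeColumn noColOrFreeRow ⟩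
    n + m ∸ 2
      ∎
    where open ≤-Reasoning

module _ {a b : ℕ} where

  cross : VSet (KK (suc a) (suc b))
  cross (zero  , _)     = true
  cross (suc _ , zero)  = true
  cross (suc _ , suc _) = false

  puncturedCross : VSet (KK (suc a) (suc b))
  puncturedCross (zero  , zero)  = false
  puncturedCross (zero  , suc _) = true
  puncturedCross (suc _ , zero)  = true
  puncturedCross (suc _ , suc _) = false

  cross-dual : IsDualMV (KK (suc a) (suc b)) cross
  cross-dual = (λ _ _ x y → cornerOutside⇒visible cross (inside x y))
             , (λ _ _ x y → cornerOutside⇒visible cross (outside x y))
    where
    inside : ∀ {i i' j j'} → cross (i , j) ≡ true → cross (i' , j') ≡ true →
      i ≢ i' → j ≢ j' → CornerOutside cross (i , j) (i' , j')
    inside {suc _} {_}     {suc _} {_}     () _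
    inside {_}     {suc _} {_}     {suc _} _  ()
    inside {zero}  {zero}  {_}     {_}     _  _ i≢i' _    = ⊥-elim (i≢i' refl)
    inside {_}     {_}     {zero}  {zero}  _  _ _    j≢j' = ⊥-elim (j≢j' refl)
    inside {zero}  {suc _} {suc _} {zero}  _  _ _    _    = inj₂ refl
    inside {suc _} {zero}  {zero}  {suc _} _  _ _    _    = inj₁ refl

    outside : ∀ {i i' j j'} → cross (i , j) ≡ false → cross (i' , j') ≡ false →
      i ≢ i' → j ≢ j' → CornerOutside cross (i , j) (i' , j')
    outside {zero}  {_}     {_}     {_}     ()
    outside {suc _} {_}     {zero}  {_}     ()
    outside {_}     {zero}  {_}     {_}     _ ()
    outside {_}     {suc _} {_}     {zero}  _ ()
    outside {suc _} {suc _} {suc _} {suc _} _ _ _ _ = inj₁ refl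

  puncturedCross-outer : IsOuterMV (KK (suc a) (suc b)) puncturedCross
  puncturedCross-outer = (λ _ _ x _ → cornerOutside⇒visible puncturedCross (corners x))
                       , (λ _ _ x _ → cornerOutside⇒visible puncturedCross (corners x))
    where
    corners : ∀ {i i' j j'} → puncturedCross (i , j) ≡ true →
      i ≢ i' → j ≢ j' → CornerOutside puncturedCross (i , j) (i' , j')
    corners {zero}  {_}     {zero}  ()
    corners {suc _} {_}     {suc _} ()
    corners {zero}  {zero}  {suc _} _ i≢i' _    = ⊥-elim (i≢i' refl)
    corners {zero}  {suc _} {suc _} _ _    _    = inj₂ refl
    corners {suc _} {_}     {zero} {zero}  _ _ j≢j' = ⊥-elim (j≢j' refl)
    corners {suc _} {_}     {zero} {suc _} _ _ _    = inj₁ refl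

  cross-card : cardKK (suc a) (suc b) cross ≡ suc a + suc b ∸ 1
  cross-card = begin
    cardKK (suc a) (suc b) cross
      ≡⟨ cardKK≡∑count cross ⟩
    count (λ j → cross (zero , j) ≟ᵇ true) + ∑[ i < a ] count (λ j → cross (suc i , j) ≟ᵇ true)
      ≡⟨ cong₂ _+_ (count≡n (λ j → cross (zero , j) ≟ᵇ true) (λ _ → refl))
                   (∑≡n {a} (λ i → cong suc (count≡0 (λ j → cross (suc i , suc j) ≟ᵇ true) (λ _ ())))) ⟩
    suc b + a
      ≡⟨ +-comm (suc b) a ⟩
    a + suc b
      ∎
    where open ≡-Reasoning

  puncturedCross-card : cardKK (suc a) (suc b) puncturedCross ≡ suc a + suc b ∸ 2
  puncturedCross-card = begin
    cardKK (suc a) (suc b) puncturedCross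
      ≡⟨ cardKK≡∑count puncturedCross ⟩
    count (λ j → puncturedCross (zero , j) ≟ᵇ true) + ∑[ i < a ] count (λ j → puncturedCross (suc i , j) ≟ᵇ true)
      ≡⟨ cong₂ _+_ (count≡n (λ j → puncturedCross (zero , suc j) ≟ᵇ true) (λ _ → refl))
                   (∑≡n {a} (λ i → cong suc (count≡0 (λ j → puncturedCross (suc i , suc j) ≟ᵇ true) (λ _ ())))) ⟩
    b + a
      ≡⟨ +-comm b a ⟩
    a + b
      ≡⟨ cong (_∸ 1) (+-suc a b) ⟨
    a + suc b ∸ 1
      ∎
    where open ≡-Reasoning

theorem2p1 : ∀ (n m : ℕ) → 3 ≤ n → 3 ≤ m →
    IsMaxCardKK n m (IsDualMV (KK n m)) (n + m ∸ 1) ×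
    IsMaxCardKK n m (IsOuterMV (KK n m)) (n + m ∸ 2)
theorem2p1 (suc a) (suc b) (s≤s 2≤a) (s≤s 2≤b) =
  ((cross , cross-dual , cross-card {a} {b}) , λ _ → dual-card≤) ,
  ((puncturedCross , puncturedCross-outer , puncturedCross-card {a} {b}) ,
   λ _ outer → OuterSplit.card≤ outer (m≤n⇒m≤1+n 2≤a) (m≤n⇒m≤1+n 2≤b))
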